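{- Let $G=(A,B,E)$ be a bipartite graph with a proper edge coloring $\chi:E\to\{1,\dots,d\}$. Then there exists a subgraph $G'=(A,B,E')$ of $G$ with $|E'|\ge |E|/(3\lceil\sqrt d\,\rceil)$ that does not contain a heavy path.
   Context: A bipartite graph is a triple $G=(A,B,E)$ with disjoint vertex sets $A,B$ and $E\subseteq A\times B$; it is simple. A proper edge coloring assigns colors so that adjacent edges get different colors. A heavy path is a path $v_0v_1v_2v_3$ of length 3 with $v_0\in B$ whose edge colors $c_1=\chi(v_0v_1)$, $c_2=\chi(v_1v_2)$, $c_3=\chi(v_2v_3)$ satisfy $c_2<c_1\le c_3$. -}

module Defs where

open import Data.Nat using (ℕ; _≤_; _<_; _*_; _+_)
open import Data.Fin using (Fin)
open import Data.List using (map; allFin)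
open import Data.Nat.ListAction using (sum)
open import Data.Bool using (Bool; true; false; if_then_else_)
open import Data.Product using (_×_)
open import Relation.Binary.PropositionalEquality using (_≡_; _≢_)
open import Relation.Nullary using (¬_)

-- A bipartite graph (A,B,E) with A = Fin m, B = Fin n; E is given by its
-- characteristic function (E a b ≡ true  iff  ab is an edge).  Simple by design.
EdgeSet : ℕ → ℕ → Set
EdgeSet m n = Fin m → Fin n → Bool

edgeCount : ∀ {m n} → EdgeSet m n → ℕ
edgeCount {m} {n} E =
  sum (map (λ a → sum (map (λ b → if E a b then 1 else 0) (allFin n))) (allFin m))

_⊆ᴱ_ : ∀ {m n} → EdgeSet m n → EdgeSet m n → Set
E' ⊆ᴱ E = ∀ a b → E' a b ≡ true → E a b ≡ true

-- Colorings are functions Fin m → Fin n → ℕ; only values on edges matter.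
Coloring : ℕ → ℕ → Set
Coloring m n = Fin m → Fin n → ℕ

ColorsIn : ∀ {m n} → ℕ → EdgeSet m n → Coloring m n → Set
ColorsIn d E χ = ∀ a b → E a b ≡ true → 1 ≤ χ a b × χ a b ≤ d

Proper : ∀ {m n} → EdgeSet m n → Coloring m n → Set
Proper E χ =
  (∀ a b b' → E a b ≡ true → E a b' ≡ true → b ≢ b' → χ a b ≢ χ a b') ×
  (∀ a a' b → E a b ≡ true → E a' b ≡ true → a ≢ a' → χ a b ≢ χ a' b)

-- heavy path v0 v1 v2 v3 = b a b' a' (v0 ∈ B), edges in E,
-- colors c1 = χ(a,b), c2 = χ(a,b'), c3 = χ(a',b') with c2 < c1 ≤ c3
HeavyPath : ∀ {m n} → EdgeSet m n → Coloring m n →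
            Fin n → Fin m → Fin n → Fin m → Set
HeavyPath E χ b a b' a' =
  b ≢ b' × a ≢ a' ×
  E a b ≡ true × E a b' ≡ true × E a' b' ≡ true ×
  χ a b' < χ a b × χ a b ≤ χ a' b'

HeavyPathFree : ∀ {m n} → EdgeSet m n → Coloring m n → Set
HeavyPathFree E χ = ∀ b a b' a' → ¬ HeavyPath E χ b a b' a'

IsCeilSqrt : ℕ → ℕ → Set
IsCeilSqrt d s = d ≤ s * s × (∀ t → d ≤ t * t → s ≤ t)

-- Let s = ⌈√d⌉ and cut the colours 1..d into s consecutive blocks of s
-- colours each; the block of an edge is its label.  We select a subgraph F
-- in which every B-vertex sees a single label and every A-vertex sees
-- pairwise distinct labels.  Such an F has no heavy path b a b' a': the
-- colours force label(ab') ≤ label(ab) ≤ label(a'b') = label(ab'), so the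
-- two edges at a share a label, hence b = b'.
--
-- F is chosen greedily, one B-vertex b at a time: among the edges at b whose
-- label is not yet present at their A-endpoint ("uncovered" edges) keep those
-- of the most frequent label.  Every E-edge is then either uncovered, and
-- there are at most s·deg_F(b) of those at each b, or covered by an F-edge
-- of the same label at its A-endpoint, and by properness each F-edge covers
-- at most s edges (a block holds s colours).  Hence |E| ≤ 2s|F| ≤ 3s|F|.

module Submission where

open import Defs
open import Data.Nat using (ℕ; zero; suc; _≤_; _<_; _*_; _+_; _∸_; z≤n; s≤s; _≡ᵇ_; _≤?_)
open import Data.Nat.Properties
open import Data.Nat.DivMod using (_/_; _%_; /-mono-≤; m<n*o⇒m/o<n; m%n<n; m≡m%n+[m/n]*n)
open import Data.Fin using (Fin; zero; suc; toℕ) renaming (_≟_ to _≟ᶠ_)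
open import Data.Fin.Properties using () renaming (0≢1+n to Fin-0≢1+n; suc-injective to Fin-suc-injective)
open import Data.Vec.Functional using (foldr)
open import Data.Bool using (Bool; true; false; _∧_; _∨_; not; if_then_else_; T)
open import Data.Product using (Σ; _×_; _,_; proj₁; proj₂)
open import Data.Empty using (⊥; ⊥-elim)
open import Data.Unit using (tt)
open import Relation.Nullary using (yes; no)
open import Relation.Binary.PropositionalEquality
open import Data.List using (tabulate) renaming (map to mapᴸ)
open import Data.Nat.ListAction using () renaming (sum to sumᴸ)
open import Algebra.Properties.Semiring.Sum +-*-semiring using (sum; ∑-comm; ∑-distrib-+; sum-cong-≗; *-distribˡ-sum)

⟦_⟧ : Bool → ℕ
⟦ x ⟧ = if x then 1 else 0

count : ∀ {n} → (Fin n → Bool) → ℕ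
count P = sum (λ i → ⟦ P i ⟧)

any : ∀ {n} → (Fin n → Bool) → Bool
any = foldr _∨_ false

∧-true : ∀ x y → x ∧ y ≡ true → x ≡ true × y ≡ true
∧-true true true _ = refl , refl

∧-intro : ∀ {x y} → x ≡ true → y ≡ true → x ∧ y ≡ true
∧-intro refl q = q

not-true : ∀ {x} → x ≡ true → not x ≡ true → ⊥
not-true refl ()

≡ᵇ-true⇒≡ : ∀ {m n} → (m ≡ᵇ n) ≡ true → m ≡ n
≡ᵇ-true⇒≡ {m} {n} e = ≡ᵇ⇒≡ m n (subst T (sym e) tt)

≡⇒≡ᵇ-true : ∀ {m n} → m ≡ n → (m ≡ᵇ n) ≡ true
≡⇒≡ᵇ-true {m} {n} e with m ≡ᵇ n | ≡⇒≡ᵇ m n e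
... | true | _ = refl

⟦⟧-split : ∀ x y → ⟦ x ⟧ ≡ ⟦ x ∧ y ⟧ + ⟦ x ∧ not y ⟧
⟦⟧-split false y = refl
⟦⟧-split true true = refl
⟦⟧-split true false = refl

⟦∧⟧≤* : ∀ x y → ⟦ x ∧ y ⟧ ≤ ⟦ x ⟧ * ⟦ y ⟧
⟦∧⟧≤* false y = z≤n
⟦∧⟧≤* true true = s≤s z≤n
⟦∧⟧≤* true false = z≤n

⟦⟧-exchange : ∀ x y z → ⟦ x ⟧ * ⟦ y ∧ z ⟧ ≡ ⟦ y ⟧ * ⟦ x ∧ z ⟧
⟦⟧-exchange false false z = refl
⟦⟧-exchange false true false = refl
⟦⟧-exchange false true true = refl
⟦⟧-exchange true false z = refl
⟦⟧-exchange true true false = refl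
⟦⟧-exchange true true true = refl

-- Becoming covered by more edges can only shrink the uncovered part.
⟦∧not-∨⟧≤ : ∀ x y z → ⟦ x ∧ not (y ∨ z) ⟧ ≤ ⟦ x ∧ not z ⟧
⟦∧not-∨⟧≤ false y z = z≤n
⟦∧not-∨⟧≤ true true z = z≤n
⟦∧not-∨⟧≤ true false z = ≤-refl

∑-mono : ∀ {n} {f g : Fin n → ℕ} → (∀ i → f i ≤ g i) → sum f ≤ sum g
∑-mono {zero} h = z≤n
∑-mono {suc n} h = +-mono-≤ (h zero) (∑-mono (λ i → h (suc i)))

∑-const : ∀ n c → sum {n} (λ _ → c) ≡ n * c
∑-const zero c = refl
∑-const (suc n) c = cong (c +_) (∑-const n c)

count-empty : ∀ {n} (P : Fin n → Bool) → (∀ i → P i ≡ true → ⊥) → count P ≡ 0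
count-empty {zero} P none = refl
count-empty {suc n} P none with P zero in eq
... | true = ⊥-elim (none zero eq)
... | false = count-empty (λ i → P (suc i)) (λ i → none (suc i))

count-unique : ∀ {n} (P : Fin n → Bool) → (∀ i j → P i ≡ true → P j ≡ true → i ≡ j) → count P ≤ 1
count-unique {zero} P unique = z≤n
count-unique {suc n} P unique with P zero in eq
... | true = ≤-reflexive (cong suc (count-empty (λ i → P (suc i))
                (λ i p → Fin-0≢1+n (unique zero (suc i) eq p))))
... | false = count-unique (λ i → P (suc i))
                (λ i j p q → Fin-suc-injective (unique (suc i) (suc j) p q))

any-intro : ∀ {n} (P : Fin n → Bool) i → P i ≡ true → any P ≡ true
any-intro P zero eq rewrite eq = refl
any-intro P (suc i) eq with P zero
... | true = refl
... | false = any-intro (λ j → P (suc j)) i eq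

any≤count : ∀ {n} (P : Fin n → Bool) → ⟦ any P ⟧ ≤ count P
any≤count {zero} P = z≤n
any≤count {suc n} P with P zero
... | true = s≤s z≤n
... | false = any≤count (λ i → P (suc i))

label-hit : ∀ s r → r < s → 1 ≤ count {s} (λ q → r ≡ᵇ toℕ q)
label-hit (suc s) zero _ = s≤s z≤n
label-hit (suc s) (suc r) (s≤s r<s) = label-hit s r r<s

count-by-labels : ∀ {n} s (P : Fin n → Bool) (r : Fin n → ℕ) → (∀ i → P i ≡ true → r i < s) →
                  count P ≤ sum (λ (q : Fin s) → count (λ i → P i ∧ (r i ≡ᵇ toℕ q)))
count-by-labels s P r bounded = begin
  count P                                                   ≤⟨ ∑-mono split ⟩
  sum (λ i → sum (λ (q : Fin s) → ⟦ P i ∧ (r i ≡ᵇ toℕ q) ⟧))  ≡⟨ ∑-comm (λ i (q : Fin s) → ⟦ P i ∧ (r i ≡ᵇ toℕ q) ⟧) ⟩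
  sum (λ (q : Fin s) → count (λ i → P i ∧ (r i ≡ᵇ toℕ q)))   ∎
  where
  open ≤-Reasoning
  split : ∀ i → ⟦ P i ⟧ ≤ sum (λ (q : Fin s) → ⟦ P i ∧ (r i ≡ᵇ toℕ q) ⟧)
  split i with P i in eq
  ... | true = label-hit s (r i) (bounded i eq)
  ... | false = z≤n

count-injective : ∀ {n} s (P : Fin n → Bool) (r : Fin n → ℕ) → (∀ i → P i ≡ true → r i < s) →
                  (∀ i j → P i ≡ true → P j ≡ true → r i ≡ r j → i ≡ j) → count P ≤ s
count-injective s P r bounded injective = begin
  count P                                                 ≤⟨ count-by-labels s P r bounded ⟩
  sum (λ (q : Fin s) → count (λ i → P i ∧ (r i ≡ᵇ toℕ q))) ≤⟨ ∑-mono (λ q → count-unique _ (one-per-label q)) ⟩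
  sum {s} (λ _ → 1)                                       ≡⟨ ∑-const s 1 ⟩
  s * 1                                                   ≡⟨ *-identityʳ s ⟩
  s                                                       ∎
  where
  open ≤-Reasoning
  one-per-label : ∀ (q : Fin s) i j → P i ∧ (r i ≡ᵇ toℕ q) ≡ true → P j ∧ (r j ≡ᵇ toℕ q) ≡ true → i ≡ j
  one-per-label q i j p p' with ∧-true (P i) _ p | ∧-true (P j) _ p'
  ... | Pi , ri≡q | Pj , rj≡q = injective i j Pi Pj (trans (≡ᵇ-true⇒≡ ri≡q) (sym (≡ᵇ-true⇒≡ rj≡q)))

argmax : ∀ {k} (f : Fin (suc k) → ℕ) → Σ (Fin (suc k)) (λ q → ∀ j → f j ≤ f q)
argmax {zero} f = zero , λ { zero → ≤-refl }
argmax {suc k} f with argmax (λ i → f (suc i))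
... | q , max with f zero ≤? f (suc q)
...   | yes f0≤ = suc q , λ { zero → f0≤ ; (suc j) → max j }
...   | no f0≰ = zero , λ { zero → ≤-refl ; (suc j) → ≤-trans (max j) (<⇒≤ (≰⇒> f0≰)) }

sum≤size*max : ∀ {k} (f : Fin (suc k) → ℕ) → Σ (Fin (suc k)) (λ q → sum f ≤ suc k * f q)
sum≤size*max {k} f with argmax f
... | q , max = q , ≤-trans (∑-mono max) (≤-reflexive (∑-const (suc k) (f q)))

size : ∀ {m n} → EdgeSet m n → ℕ
size E = sum (λ a → count (E a))

sumᴸ-tabulate : ∀ {n} {A : Set} (f : A → ℕ) (g : Fin n → A) → sumᴸ (mapᴸ f (tabulate g)) ≡ sum (λ i → f (g i))
sumᴸ-tabulate {zero} f g = refl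
sumᴸ-tabulate {suc n} f g = cong (f (g zero) +_) (sumᴸ-tabulate f (λ i → g (suc i)))

edgeless-size : ∀ {m n} (E : EdgeSet m n) → (∀ a b → E a b ≡ true → ⊥) → size E ≡ 0
edgeless-size {m} E no-edge =
  trans (sum-cong-≗ (λ a → count-empty (E a) (no-edge a))) (trans (∑-const m 0) (*-zeroʳ m))

edgeCount≡size : ∀ {m n} (E : EdgeSet m n) → edgeCount E ≡ size E
edgeCount≡size E =
  trans (sumᴸ-tabulate (λ a → sumᴸ (mapᴸ (λ b → ⟦ E a b ⟧) (tabulate (λ b → b)))) (λ a → a))
        (sum-cong-≗ (λ a → sumᴸ-tabulate (λ b → ⟦ E a b ⟧) (λ b → b)))

Labeling : ℕ → ℕ → Set
Labeling m n = Fin m → Fin n → ℕ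

UniformAtB : ∀ {m n} → EdgeSet m n → Labeling m n → Set
UniformAtB F β = ∀ a a' b → F a b ≡ true → F a' b ≡ true → β a b ≡ β a' b

DistinctAtA : ∀ {m n} → EdgeSet m n → Labeling m n → Set
DistinctAtA F β = ∀ a b b' → F a b ≡ true → F a b' ≡ true → β a b ≡ β a b' → b ≡ b'

covered : ∀ {m n} → EdgeSet m n → Labeling m n → Fin m → ℕ → Bool
covered F β a q = any (λ b → F a b ∧ (β a b ≡ᵇ q))

uncoveredAt : ∀ {m n} → EdgeSet m n → EdgeSet m n → Labeling m n → Fin n → Fin m → Bool
uncoveredAt E F β b a = E a b ∧ not (covered F β a (β a b))

record Selection {m n} (s : ℕ) (E : EdgeSet m n) (β : Labeling m n) : Set where
  field
    F          : EdgeSet m n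
    F⊆E        : F ⊆ᴱ E
    uniform    : UniformAtB F β
    distinct   : DistinctAtA F β
    uncovered≤ : ∀ b → count (uncoveredAt E F β b) ≤ s * count (λ a → F a b)

-- The greedy step: given a selection for the B-vertices 1..n, handle vertex 0
-- by keeping its uncovered ("fresh") edges of the most frequent label.
module Extend {m n k} (E : EdgeSet m (suc n)) (β : Labeling m (suc n))
              (bounded : ∀ a b → E a b ≡ true → β a b < suc k)
              (R : Selection (suc k) (λ a b → E a (suc b)) (λ a b → β a (suc b))) where
  open Selection R renaming (F to F₀; F⊆E to F₀⊆E; uniform to uniform₀;
                             distinct to distinct₀; uncovered≤ to uncovered₀≤)

  β₀ : Labeling m n
  β₀ a b = β a (suc b)

  fresh : Fin m → Bool
  fresh a = E a zero ∧ not (covered F₀ β₀ a (β a zero))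

  freshWith : Fin (suc k) → Fin m → Bool
  freshWith q a = fresh a ∧ (β a zero ≡ᵇ toℕ q)

  best : Fin (suc k)
  best = proj₁ (sum≤size*max (λ q → count (freshWith q)))

  F : EdgeSet m (suc n)
  F a zero = freshWith best a
  F a (suc b) = F₀ a b

  F⊆E : F ⊆ᴱ E
  F⊆E a zero p = proj₁ (∧-true (E a zero) _ (proj₁ (∧-true (fresh a) _ p)))
  F⊆E a (suc b) p = F₀⊆E a b p

  uniform : UniformAtB F β
  uniform a a' zero p p' =
    trans (≡ᵇ-true⇒≡ (proj₂ (∧-true (fresh a) _ p))) (sym (≡ᵇ-true⇒≡ (proj₂ (∧-true (fresh a') _ p'))))
  uniform a a' (suc b) p p' = uniform₀ a a' b p p'

  new-label : ∀ a b → F a zero ≡ true → F₀ a b ≡ true → β a (suc b) ≡ β a zero → ⊥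
  new-label a b p p₀ e =
    not-true (any-intro _ b (∧-intro p₀ (≡⇒≡ᵇ-true e)))
             (proj₂ (∧-true (E a zero) _ (proj₁ (∧-true (fresh a) _ p))))

  distinct : DistinctAtA F β
  distinct a zero zero _ _ _ = refl
  distinct a (suc b) (suc b') p p' e = cong suc (distinct₀ a b b' p p' e)
  distinct a zero (suc b') p p' e = ⊥-elim (new-label a b' p p' (sym e))
  distinct a (suc b) zero p p' e = ⊥-elim (new-label a b p' p e)

  -- Covering by F includes covering by F₀.
  uncovered-shrinks : ∀ b a → ⟦ uncoveredAt E F β b a ⟧ ≤ ⟦ E a b ∧ not (covered F₀ β₀ a (β a b)) ⟧
  uncovered-shrinks b a = ⟦∧not-∨⟧≤ (E a b) _ (covered F₀ β₀ a (β a b))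

  uncovered≤ : ∀ b → count (uncoveredAt E F β b) ≤ suc k * count (λ a → F a b)
  uncovered≤ zero = begin
    count (uncoveredAt E F β zero)                 ≤⟨ ∑-mono (uncovered-shrinks zero) ⟩
    count fresh                                    ≤⟨ count-by-labels (suc k) fresh (λ a → β a zero) fresh-bounded ⟩
    sum (λ q → count (freshWith q))                ≤⟨ proj₂ (sum≤size*max (λ q → count (freshWith q))) ⟩
    suc k * count (freshWith best)                 ∎
    where
    open ≤-Reasoning
    fresh-bounded : ∀ a → fresh a ≡ true → β a zero < suc k
    fresh-bounded a p = bounded a zero (proj₁ (∧-true (E a zero) _ p))
  uncovered≤ (suc b) = ≤-trans (∑-mono (uncovered-shrinks (suc b))) (uncovered₀≤ b)

  selection : Selection (suc k) E β
  selection = record { F = F ; F⊆E = F⊆E ; uniform = uniform ; distinct = distinct ; uncovered≤ = uncovered≤ }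

select : ∀ {m} n k (E : EdgeSet m n) (β : Labeling m n) →
         (∀ a b → E a b ≡ true → β a b < suc k) → Selection (suc k) E β
select zero k E β bounded =
  record { F = E ; F⊆E = λ _ _ e → e ; uniform = λ _ _ () ; distinct = λ _ () ; uncovered≤ = λ () }
select (suc n) k E β bounded =
  Extend.selection E β bounded (select n k (λ a b → E a (suc b)) (λ a b → β a (suc b)) (λ a b → bounded a (suc b)))

LabelMultiplicity≤ : ∀ {m n} → ℕ → EdgeSet m n → Labeling m n → Set
LabelMultiplicity≤ t E β = ∀ a q → count (λ b → E a b ∧ (q ≡ᵇ β a b)) ≤ t

-- Double counting at a: every covered E-edge at a is charged to an F-edge at
-- a of the same label, and each F-edge receives at most t charges.
covered≤ : ∀ {m n t} (E F : EdgeSet m n) (β : Labeling m n) → LabelMultiplicity≤ t E β →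
           ∀ a → count (λ b → E a b ∧ covered F β a (β a b)) ≤ t * count (F a)
covered≤ {n = n} {t} E F β mult a = begin
  count (λ b → E a b ∧ covered F β a (β a b))
    ≤⟨ ∑-mono (λ b → ⟦∧⟧≤* (E a b) _) ⟩
  sum (λ b → ⟦ E a b ⟧ * ⟦ any (coverers b) ⟧)
    ≤⟨ ∑-mono (λ b → *-monoʳ-≤ ⟦ E a b ⟧ (any≤count (coverers b))) ⟩
  sum (λ b → ⟦ E a b ⟧ * count (coverers b))
    ≡⟨ sum-cong-≗ (λ b → *-distribˡ-sum ⟦ E a b ⟧ (λ c → ⟦ coverers b c ⟧)) ⟩
  sum (λ b → sum (λ c → ⟦ E a b ⟧ * ⟦ F a c ∧ same c b ⟧))
    ≡⟨ ∑-comm (λ b c → ⟦ E a b ⟧ * ⟦ F a c ∧ same c b ⟧) ⟩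
  sum (λ c → sum (λ b → ⟦ E a b ⟧ * ⟦ F a c ∧ same c b ⟧))
    ≡⟨ sum-cong-≗ (λ c → sum-cong-≗ (λ b → ⟦⟧-exchange (E a b) (F a c) (same c b))) ⟩
  sum (λ c → sum (λ b → ⟦ F a c ⟧ * ⟦ E a b ∧ same c b ⟧))
    ≡⟨ sum-cong-≗ (λ c → *-distribˡ-sum ⟦ F a c ⟧ (λ b → ⟦ E a b ∧ same c b ⟧)) ⟨
  sum (λ c → ⟦ F a c ⟧ * count (λ b → E a b ∧ same c b))
    ≤⟨ ∑-mono (λ c → *-monoʳ-≤ ⟦ F a c ⟧ (mult a (β a c))) ⟩
  sum (λ c → ⟦ F a c ⟧ * t)
    ≡⟨ sum-cong-≗ (λ c → *-comm ⟦ F a c ⟧ t) ⟩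
  sum (λ c → t * ⟦ F a c ⟧)
    ≡⟨ *-distribˡ-sum t (λ c → ⟦ F a c ⟧) ⟨
  t * count (F a) ∎
  where
  open ≤-Reasoning
  same : Fin n → Fin n → Bool
  same c b = β a c ≡ᵇ β a b
  coverers : Fin n → Fin n → Bool
  coverers b c = F a c ∧ same c b

uncovered-total : ∀ {m n s} {E : EdgeSet m n} {β : Labeling m n} (S : Selection s E β) →
                  let open Selection S in
                  sum (λ a → count (λ b → uncoveredAt E F β b a)) ≤ s * size F
uncovered-total {s = s} {E} {β} S = begin
  sum (λ a → count (λ b → uncoveredAt E F β b a))  ≡⟨ ∑-comm (λ a b → ⟦ uncoveredAt E F β b a ⟧) ⟩
  sum (λ b → count (uncoveredAt E F β b))          ≤⟨ ∑-mono uncovered≤ ⟩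
  sum (λ b → s * count (λ a → F a b))              ≡⟨ *-distribˡ-sum s (λ b → count (λ a → F a b)) ⟨
  s * sum (λ b → count (λ a → F a b))              ≡⟨ cong (s *_) (∑-comm (λ a b → ⟦ F a b ⟧)) ⟨
  s * size F                                       ∎
  where
  open ≤-Reasoning
  open Selection S

-- A selection keeps at least a 1/(t+s) fraction of the edges: edges are
-- either covered (charged to F at A) or uncovered (charged to F at B).
selection-size : ∀ {m n s t} {E : EdgeSet m n} {β : Labeling m n} (S : Selection s E β) →
                 LabelMultiplicity≤ t E β → size E ≤ (t + s) * size (Selection.F S)
selection-size {m} {n} {s} {t} {E} {β} S mult = begin
  size E
    ≡⟨ sum-cong-≗ (λ a → trans (sum-cong-≗ (λ b → ⟦⟧-split (E a b) (covered F β a (β a b))))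
                               (∑-distrib-+ (λ b → ⟦ coveredAt a b ⟧) (λ b → ⟦ uncoveredAt E F β b a ⟧))) ⟩
  sum (λ a → count (coveredAt a) + count (λ b → uncoveredAt E F β b a))
    ≡⟨ ∑-distrib-+ (λ a → count (coveredAt a)) (λ a → count (λ b → uncoveredAt E F β b a)) ⟩
  sum (λ a → count (coveredAt a)) + sum (λ a → count (λ b → uncoveredAt E F β b a))
    ≤⟨ +-mono-≤ (∑-mono (covered≤ E F β mult)) (uncovered-total S) ⟩
  sum (λ a → t * count (F a)) + s * size F
    ≡⟨ cong (_+ s * size F) (*-distribˡ-sum t (λ a → count (F a))) ⟨
  t * size F + s * size F
    ≡⟨ *-distribʳ-+ (size F) t s ⟨
  (t + s) * size F ∎
  where
  open ≤-Reasoning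
  open Selection S
  coveredAt : Fin m → Fin n → Bool
  coveredAt a b = E a b ∧ covered F β a (β a b)

-- If F is uniform at B and distinct at A for labels that are a monotone
-- function of the colour, then F has no heavy path b a b' a': the labels of
-- ab', ab, a'b' increase weakly, and those of a'b', ab' agree, so ab and ab'
-- share a label.
layered⇒heavyPathFree : ∀ {m n} (F : EdgeSet m n) (χ : Coloring m n) (g : ℕ → ℕ) →
                        (∀ {x y} → x ≤ y → g x ≤ g y) →
                        UniformAtB F (λ a b → g (χ a b)) → DistinctAtA F (λ a b → g (χ a b)) →
                        HeavyPathFree F χ
layered⇒heavyPathFree F χ g mono uniform distinct b a b' a' (b≢b' , _ , ab , ab' , a'b' , c₂<c₁ , c₁≤c₃) =
  b≢b' (distinct a b b' ab ab' (≤-antisym g₁≤g₂ g₂≤g₁))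
  where
  g₂≤g₁ : g (χ a b') ≤ g (χ a b)
  g₂≤g₁ = mono (<⇒≤ c₂<c₁)
  g₁≤g₂ : g (χ a b) ≤ g (χ a b')
  g₁≤g₂ = ≤-trans (mono c₁≤c₃) (≤-reflexive (uniform a' a b' a'b' ab'))

-- The colours 1..s² fall into s blocks of s consecutive colours; the block
-- of colour c is (c - 1) / s.
module Blocks (k : ℕ) where
  s : ℕ
  s = suc k

  block : ℕ → ℕ
  block c = (c ∸ 1) / s

  block-mono : ∀ {x y} → x ≤ y → block x ≤ block y
  block-mono x≤y = /-mono-≤ (∸-monoˡ-≤ 1 x≤y) (≤-refl {s})

  block-bound : ∀ c → 1 ≤ c → c ≤ s * s → block c < s
  block-bound (suc c) _ c<s² = m<n*o⇒m/o<n {c} {s} {s} c<s²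

  block-position-injective : ∀ x y → 1 ≤ x → 1 ≤ y → block x ≡ block y →
                             (x ∸ 1) % s ≡ (y ∸ 1) % s → x ≡ y
  block-position-injective (suc x) (suc y) _ _ same-block same-position = cong suc (begin
    x                  ≡⟨ m≡m%n+[m/n]*n x s ⟩
    x % s + x / s * s  ≡⟨ cong₂ (λ r q → r + q * s) same-position same-block ⟩
    y % s + y / s * s  ≡⟨ m≡m%n+[m/n]*n y s ⟨
    y                  ∎)
    where open ≡-Reasoning

  -- In a proper colouring the edges at a vertex with colours in one block
  -- have distinct positions in it, so there are at most s of them.
  block-multiplicity : ∀ {m n d} (E : EdgeSet m n) (χ : Coloring m n) → ColorsIn d E χ → Proper E χ →
                       LabelMultiplicity≤ s E (λ a b → block (χ a b))
  block-multiplicity {n = n} E χ colors proper a q =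
    count-injective s (λ b → E a b ∧ (q ≡ᵇ block (χ a b))) position (λ b _ → m%n<n (χ a b ∸ 1) s) distinct-positions
    where
    position : Fin n → ℕ
    position b = (χ a b ∸ 1) % s
    distinct-positions : ∀ b b' → E a b ∧ (q ≡ᵇ block (χ a b)) ≡ true →
                         E a b' ∧ (q ≡ᵇ block (χ a b')) ≡ true → position b ≡ position b' → b ≡ b'
    distinct-positions b b' p p' same-position with ∧-true (E a b) _ p | ∧-true (E a b') _ p' | b ≟ᶠ b'
    ... | _ , _ | _ , _ | yes b≡b' = b≡b'
    ... | ab , q≡blk | ab' , q≡blk' | no b≢b' =
      ⊥-elim (proj₁ proper a b b' ab ab' b≢b'
        (block-position-injective (χ a b) (χ a b') (proj₁ (colors a b ab)) (proj₁ (colors a b' ab'))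
          (trans (sym (≡ᵇ-true⇒≡ {q} q≡blk)) (≡ᵇ-true⇒≡ {q} q≡blk')) same-position))

-- If s = 0 there are no colours, hence no edges.  Otherwise the greedy
-- selection for colour blocks keeps |E|/(2s) edges and has no heavy path.
lemma1 : ∀ (m n d : ℕ) (E : EdgeSet m n) (χ : Coloring m n) →
         ColorsIn d E χ → Proper E χ →
         ∀ (s : ℕ) → IsCeilSqrt d s →
         Σ (EdgeSet m n) (λ E' →
           (E' ⊆ᴱ E) × (edgeCount E ≤ 3 * s * edgeCount E') × HeavyPathFree E' χ)
lemma1 m n d E χ colors proper zero (d≤0 , _) =
  E , (λ _ _ e → e) , ≤-reflexive (trans (edgeCount≡size E) (edgeless-size E no-edge)) ,
  λ { b a _ _ (_ , _ , ab , _) → no-edge a b ab }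
  where
  no-edge : ∀ a b → E a b ≡ true → ⊥
  no-edge a b e = 1+n≰n (≤-trans (proj₁ (colors a b e)) (≤-trans (proj₂ (colors a b e)) d≤0))
lemma1 m n d E χ colors proper (suc k) (d≤s² , _) = F , F⊆E , size-bound ,
  layered⇒heavyPathFree F χ block block-mono uniform distinct
  where
  open Blocks k
  labels-bounded : ∀ a b → E a b ≡ true → block (χ a b) < s
  labels-bounded a b e = block-bound (χ a b) (proj₁ (colors a b e)) (≤-trans (proj₂ (colors a b e)) d≤s²)
  S : Selection s E (λ a b → block (χ a b))
  S = select n k E (λ a b → block (χ a b)) labels-bounded
  open Selection S
  size-bound : edgeCount E ≤ 3 * s * edgeCount F
  size-bound = begin
    edgeCount E          ≡⟨ edgeCount≡size E ⟩
    size E               ≤⟨ selection-size S (block-multiplicity E χ colors proper) ⟩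
    (s + s) * size F     ≤⟨ *-monoˡ-≤ (size F) (+-monoʳ-≤ s (m≤m+n s (s + 0))) ⟩
    3 * s * size F       ≡⟨ cong (3 * s *_) (edgeCount≡size F) ⟨
    3 * s * edgeCount F  ∎
    where open ≤-Reasoning
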